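{- Let $F$ be a Morse stack on a normal $d$-pseudomanifold $M$. Then the watershed forest of $F$ is a spanning forest for $\mathfrak{min}(F)$.
   Context: A simplex is a non-empty finite set; its dimension is its cardinality minus one. A complex is a finite set $X$ of simplexes closed under taking non-empty subsets; elements are faces; facets are maximal faces; a subcomplex is a subset that is a complex. A covering pair (or $p$-pair) is a pair $(x,y)$ of faces with $x\subseteq y$, $\dim y=p$, $\dim x=p-1$; it is a free pair of $X$ if $y$ is the only face of $X$ other than $x$ containing $x$. A path in a set of simplexes is a sequence with consecutive elements comparable for inclusion; connected components are defined via such paths; a strong $d$-path is a path whose consecutive elements form $d$-pairs in one order or the other. A subset of $X$ is open if closed under supersets within $X$. A normal $d$-pseudomanifold ($d\ge1$) is a connected complex $M$ whose facets all have dimension $d$, in which each $(d-1)$-face lies in exactly two $d$-faces, and every connected open subset $S$ is strongly connected (any two facets of $S$ joined by a strong $d$-path in $S$). A stack on $X$ is $F:X\to\mathbb Z$ with $F(x)\ge F(y)$ whenever $x\subseteq y$; $F[\lambda]=\{x:F(x)\ge\lambda\}$; a minimum of $F$ (at altitude $\lambda$) is a connected component $A$ of $X\setminus F[\lambda+1]$ with $A\cap(X\setminus F[\lambda])=\emptyset$; $\mathfrak{min}(F)$ is the union of the minima. A flat pair is a covering pair $(x,y)$ with $F(x)=F(y)$; $F$ is a Morse stack if each face is in at most one flat pair. If $(x,y)$ is a covering pair with $F(x)>F(y)$, then $(y,x)$ is a differential pair. For a Morse stack on $M$, every minimum is of the form $\{m\}$ with $m$ a $d$-face. A graph is a complex of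 dimension at most 1. The facet graph $\Upsilon_M$ of $M$ has vertices $\{x\}$ for the $d$-faces $x$ of $M$ and edges $\{x,y\}$ for the pairs of $d$-faces with $x\cap y$ a $(d-1)$-face. For a nonempty set $R$ of vertices (0-simplices) and a graph $Y$ with $R\subseteq Y$, $Y$ is a forest rooted by $R$ if either $Y=R$, or there is a free pair $(v,e)$ of $Y$ (a vertex $v$ and an edge $e$) such that $Y\setminus\{v,e\}$ contains $R$ and is a forest rooted by $R$. With $R=\{\{m\}: m\in\mathfrak{min}(F)\}$, a subgraph $Y$ of $\Upsilon_M$ is a spanning forest for $\mathfrak{min}(F)$ if it is a forest rooted by $R$ containing all vertices of $\Upsilon_M$. The watershed forest of $F$ is the subgraph $G$ of $\Upsilon_M$ containing all vertices of $\Upsilon_M$ and exactly those edges $\{x,y\}$ such that either ($(x,x\cap y)$ is a differential pair and $(x\cap y,y)$ is a flat pair) or ($(y,x\cap y)$ is a differential pair and $(x\cap y,x)$ is a flat pair). -}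

module Defs where

open import Level using (0ℓ)
open import Data.Nat using (ℕ; suc; _≤_)
open import Data.Integer using (ℤ) renaming (_≤_ to _≤ℤ_; _<_ to _<ℤ_; _+_ to _+ℤ_)
open import Data.Bool using (Bool; T)
open import Data.Fin.Subset using (Subset; _⊆_; _∩_; ∣_∣; Nonempty)
open import Data.Product using (Σ; ∃; _×_)
open import Data.Sum using (_⊎_)
open import Relation.Nullary using (¬_)
open import Relation.Binary.PropositionalEquality using (_≡_; _≢_)
open import Relation.Binary.Construct.Closure.ReflexiveTransitive using (Star)

-- Convention: vertices of simplexes are drawn from Fin n; a simplex is a
-- (non-empty) Subset n.  A finite set of simplexes is a Bool-valued
-- characteristic function on Subset n.

SSet : ℕ → Set
SSet n = Subset n → Bool

module _ {n : ℕ} where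

  infix 4 _∈ₛ_
  _∈ₛ_ : Subset n → SSet n → Set
  x ∈ₛ S = T (S x)

  -- dim x = ∣ x ∣ - 1 ;  "dim x = p" is rendered as ∣ x ∣ ≡ suc p.

  IsComplex : SSet n → Set
  IsComplex X =
    (∀ x → x ∈ₛ X → Nonempty x) ×
    (∀ x y → x ∈ₛ X → y ⊆ x → Nonempty y → y ∈ₛ X)

  CoveringPair : SSet n → Subset n → Subset n → Set
  CoveringPair X x y = x ∈ₛ X × y ∈ₛ X × x ⊆ y × ∣ y ∣ ≡ suc ∣ x ∣

  DPair : ℕ → Subset n → Subset n → Set
  DPair d x y = x ⊆ y × ∣ y ∣ ≡ suc d × ∣ x ∣ ≡ d

  Comparable : Subset n → Subset n → Set
  Comparable x y = x ⊆ y ⊎ y ⊆ x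

  PathStep : SSet n → Subset n → Subset n → Set
  PathStep S a b = a ∈ₛ S × b ∈ₛ S × Comparable a b

  StrongStep : ℕ → SSet n → Subset n → Subset n → Set
  StrongStep d S a b = a ∈ₛ S × b ∈ₛ S × (DPair d a b ⊎ DPair d b a)

  Connected : SSet n → Set
  Connected S = (∃ λ x → x ∈ₛ S) ×
    (∀ x y → x ∈ₛ S → y ∈ₛ S → Star (PathStep S) x y)

  IsComponent : (Subset n → Set) → SSet n → Set
  IsComponent P A =
    (∀ x → x ∈ₛ A → P x) × Connected A ×
    (∀ x y → x ∈ₛ A → P y → Comparable x y → y ∈ₛ A)

  IsFacetOf : SSet n → Subset n → Set
  IsFacetOf S x = x ∈ₛ S × (∀ y → y ∈ₛ S → x ⊆ y → y ≡ x)

  IsOpen : SSet n → SSet n → Set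
  IsOpen X S = (∀ x → x ∈ₛ S → x ∈ₛ X) × (∀ x y → x ∈ₛ S → y ∈ₛ X → x ⊆ y → y ∈ₛ S)

  StronglyConnected : ℕ → SSet n → Set
  StronglyConnected d S =
    ∀ x y → IsFacetOf S x → IsFacetOf S y → Star (StrongStep d S) x y

  DFace : ℕ → SSet n → Subset n → Set
  DFace d X y = y ∈ₛ X × ∣ y ∣ ≡ suc d

  IsNormalPseudomanifold : ℕ → SSet n → Set
  IsNormalPseudomanifold d M =
    1 ≤ d × IsComplex M × Connected M ×
    (∀ x → IsFacetOf M x → ∣ x ∣ ≡ suc d) ×
    (∀ x → x ∈ₛ M → ∣ x ∣ ≡ d →
       Σ (Subset n) λ y₁ → Σ (Subset n) λ y₂ →
         y₁ ≢ y₂ × DFace d M y₁ × x ⊆ y₁ × DFace d M y₂ × x ⊆ y₂ ×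
         (∀ y → DFace d M y → x ⊆ y → y ≡ y₁ ⊎ y ≡ y₂)) ×
    (∀ S → IsOpen M S → Connected S → StronglyConnected d S)

  -- stacks (functions are given on all of Subset n; only values on X matter)

  IsStack : SSet n → (Subset n → ℤ) → Set
  IsStack X F = ∀ x y → x ∈ₛ X → y ∈ₛ X → x ⊆ y → F y ≤ℤ F x

  FlatPair : SSet n → (Subset n → ℤ) → Subset n → Subset n → Set
  FlatPair X F x y = CoveringPair X x y × F x ≡ F y

  DifferentialPair : SSet n → (Subset n → ℤ) → Subset n → Subset n → Set
  DifferentialPair X F y x = CoveringPair X x y × F y <ℤ F x

  -- each face is in at most one flat pair
  IsMorseStack : SSet n → (Subset n → ℤ) → Set
  IsMorseStack X F = IsStack X F ×
    (∀ z x y x′ y′ → FlatPair X F x y → FlatPair X F x′ y′ →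
       (z ≡ x ⊎ z ≡ y) → (z ≡ x′ ⊎ z ≡ y′) → x ≡ x′ × y ≡ y′)

  -- X \ F[λ+1] = faces of X with F ≤ λ  (i.e. not F ≥ λ + 1)
  Below : SSet n → (Subset n → ℤ) → ℤ → Subset n → Set
  Below X F l x = x ∈ₛ X × F x ≤ℤ l

  IsMinimum : SSet n → (Subset n → ℤ) → ℤ → SSet n → Set
  IsMinimum X F l A = IsComponent (Below X F l) A ×
    (∀ x → x ∈ₛ A → l ≤ℤ F x)

  InMin : SSet n → (Subset n → ℤ) → Subset n → Set
  InMin X F x = Σ ℤ λ λ′ → Σ (SSet n) λ A → IsMinimum X F λ′ A × x ∈ₛ A

  -- graphs whose vertices are (0-simplexes {x} on) faces x : Subset n;
  -- the edge {x , y} is represented by E x y (symmetric, irreflexive).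

record Graph (n : ℕ) : Set₁ where
  field
    V : Subset n → Set
    E : Subset n → Subset n → Set
open Graph public

module _ {n : ℕ} where

  IsGraph : Graph n → Set
  IsGraph Y = (∀ a b → E Y a b → E Y b a) × (∀ a → ¬ E Y a a) ×
              (∀ a b → E Y a b → V Y a × V Y b)

  FreePair : Graph n → Subset n → Subset n → Set
  FreePair Y v w = V Y v × E Y v w × (∀ u → E Y v u → u ≡ w)

  remove : Graph n → Subset n → Subset n → Graph n
  remove Y v w = record
    { V = λ x → V Y x × x ≢ v
    ; E = λ a b → E Y a b × ¬ ((a ≡ v × b ≡ w) ⊎ (a ≡ w × b ≡ v)) }

  data Forest (R : Subset n → Set) : Graph n → Set₁ where
    base : ∀ {Y} → (∀ x → V Y x → R x) → (∀ x → R x → V Y x) →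
           (∀ a b → ¬ E Y a b) → Forest R Y
    step : ∀ {Y} v w → FreePair Y v w →
           (∀ x → R x → V (remove Y v w) x) →
           Forest R (remove Y v w) → Forest R Y

  FacetGraph : ℕ → SSet n → Graph n
  FacetGraph d M = record
    { V = DFace d M
    ; E = λ x y → DFace d M x × DFace d M y × (x ∩ y) ∈ₛ M × ∣ x ∩ y ∣ ≡ d }

  IsSubgraph : Graph n → Graph n → Set
  IsSubgraph Y Z = IsGraph Y × (∀ x → V Y x → V Z x) × (∀ a b → E Y a b → E Z a b)

  IsSpanningForest : ℕ → SSet n → (Subset n → ℤ) → Graph n → Set₁
  IsSpanningForest d M F Y =
    IsSubgraph Y (FacetGraph d M) × Forest (InMin M F) Y ×
    (∀ x → V (FacetGraph d M) x → V Y x)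

  WatershedForest : ℕ → SSet n → (Subset n → ℤ) → Graph n
  WatershedForest d M F = record
    { V = DFace d M
    ; E = λ x y → E (FacetGraph d M) x y ×
          ((DifferentialPair M F x (x ∩ y) × FlatPair M F (x ∩ y) y) ⊎
           (DifferentialPair M F y (x ∩ y) × FlatPair M F (x ∩ y) x)) }

-- Say that a d-face a drains into a neighbour b, a ⇝ b, when their common
-- (d-1)-face t = a ∩ b is a flat facet of a and F b < F t; the watershed edges
-- are exactly the ⇝-steps.  In a Morse stack a has at most one flat facet, and
-- that facet has exactly two cofaces, so a drains into exactly one neighbour
-- if it has a flat facet and into none otherwise; the d-faces without a flat
-- facet are precisely the points of the minima.  As F strictly decreases along
-- ⇝, the highest non-minimal d-face has no incoming edge, so it forms a free
-- pair with its outgoing edge; removing such pairs one by one dismantles the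
-- graph down to the minima.

module Submission where

open import Defs
open import Data.Nat using (ℕ; zero; suc; _≤_; _<_; _≤?_; s≤s)
import Data.Nat.Properties as ℕ
open import Data.Integer using (ℤ) renaming (_≤_ to _≤ℤ_; _<_ to _<ℤ_)
import Data.Integer.Properties as ℤ
open import Data.Bool using (T?)
import Data.Bool as Bool
open import Data.Vec using ([]; _∷_; here)
open import Data.Vec.Properties using (≡-dec)
open import Data.Fin.Subset
  using (Subset; inside; outside; _⊆_; _⊃_; _⊄_; _∩_; ∣_∣; Nonempty)
open import Data.Fin.Subset.Properties
  using (⊆-refl; ⊆-trans; ⊆-antisym; drop-∷-⊆; s⊆s; out⊆; p⊆q⇒∣p∣≤∣q∣;
         p⊂q⇒∣p∣<∣q∣; _∈?_; _⊆?_; p∩q⊆p; p∩q⊆q; x∈p∩q⁺; ∩-comm; ∩-idem; _⊂?_; anySubset?)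
open import Data.Fin.Subset.Induction using (Acc; acc; ⊃-wellFounded)
open import Data.List using (List; []; _∷_; _++_; map; filter; length)
open import Data.List.Properties using (filter-notAll)
open import Data.List.Membership.Propositional using (_∈_)
open import Data.List.Membership.Propositional.Properties
  using (∈-filter⁺; ∈-filter⁻; ∈-map⁺; ∈-++⁺ˡ; ∈-++⁺ʳ)
open import Data.List.Relation.Unary.Any using (here; there)
import Data.List.Relation.Unary.Any as Any
open import Data.List.Relation.Unary.All using (lookup)
open import Data.List.Extrema ℤ.≤-totalOrder
  using (argmax; argmax-sel; f[⊥]≤f[argmax]; f[xs]≤f[argmax])
open import Data.Product using (Σ; ∃; _×_; _,_; proj₁; proj₂)
open import Data.Sum using (_⊎_; inj₁; inj₂; [_,_]′)
import Data.Sum as Sum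
open import Data.Empty using (⊥-elim)
open import Function using (_∘_; id)
open import Relation.Nullary using (¬_; Dec; yes; no; contradiction)
open import Relation.Nullary.Decidable
  using (¬?; _×-dec_; isYes; toWitness; fromWitness; decidable-stable)
open import Relation.Binary.Definitions using (DecidableEquality)
open import Relation.Binary.PropositionalEquality
  using (_≡_; _≢_; refl; sym; trans; subst; cong)
open import Relation.Binary.Construct.Closure.ReflexiveTransitive using (Star; ε)

private
  variable
    n k : ℕ
    p q r : Subset n

_≟ₛ_ : DecidableEquality (Subset n)
_≟ₛ_ = ≡-dec Bool._≟_

p⊆q∧p⊄q⇒p≡q : p ⊆ q → p ⊄ q → p ≡ q
p⊆q∧p⊄q⇒p≡q {p = p} p⊆q p⊄q = ⊆-antisym p⊆q λ {i} i∈q →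
  decidable-stable (i ∈? p) (λ i∉p → p⊄q (p⊆q , i , i∈q , i∉p))

p⊆q∧∣q∣≤∣p∣⇒p≡q : p ⊆ q → ∣ q ∣ ≤ ∣ p ∣ → p ≡ q
p⊆q∧∣q∣≤∣p∣⇒p≡q p⊆q ∣q∣≤∣p∣ =
  p⊆q∧p⊄q⇒p≡q p⊆q (λ p⊂q → ℕ.<⇒≱ (p⊂q⇒∣p∣<∣q∣ p⊂q) ∣q∣≤∣p∣)

∃-between : (p q : Subset n) (k : ℕ) → p ⊆ q → ∣ p ∣ ≤ k → k ≤ ∣ q ∣ →
            ∃ λ r → p ⊆ r × r ⊆ q × ∣ r ∣ ≡ k
∃-between [] [] zero _ _ _ = [] , ⊆-refl , ⊆-refl , refl
∃-between (outside ∷ p) (outside ∷ q) k p⊆q p≤k k≤q =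
  let r , p⊆r , r⊆q , ∣r∣ = ∃-between p q k (drop-∷-⊆ p⊆q) p≤k k≤q
  in outside ∷ r , s⊆s p⊆r , s⊆s r⊆q , ∣r∣
∃-between (inside ∷ p) (inside ∷ q) (suc k) p⊆q (s≤s p≤k) (s≤s k≤q) =
  let r , p⊆r , r⊆q , ∣r∣ = ∃-between p q k (drop-∷-⊆ p⊆q) p≤k k≤q
  in inside ∷ r , s⊆s p⊆r , s⊆s r⊆q , cong suc ∣r∣
∃-between (outside ∷ p) (inside ∷ q) k p⊆q p≤k k≤1+q with k ≤? ∣ q ∣
... | yes k≤q =
  let r , p⊆r , r⊆q , ∣r∣ = ∃-between p q k (drop-∷-⊆ p⊆q) p≤k k≤q
  in outside ∷ r , s⊆s p⊆r , out⊆ r⊆q , ∣r∣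
... | no k≰q = inside ∷ q , p⊆q , ⊆-refl , ℕ.≤-antisym (ℕ.≰⇒> k≰q) k≤1+q
∃-between (inside ∷ p) (outside ∷ q) k p⊆q _ _ = contradiction (p⊆q here) λ ()

∩-distinct-covers : ∣ p ∣ ≡ suc k → ∣ q ∣ ≡ suc k → p ≢ q →
                    r ⊆ p → r ⊆ q → ∣ r ∣ ≡ k → p ∩ q ≡ r
∩-distinct-covers {p = p} {k} {q} {r} ∣p∣ ∣q∣ p≢q r⊆p r⊆q ∣r∣
  with ∣ p ∩ q ∣ ≤? ∣ r ∣
... | yes ∣p∩q∣≤∣r∣ = sym (p⊆q∧∣q∣≤∣p∣⇒p≡q r⊆p∩q ∣p∩q∣≤∣r∣)
  where
  r⊆p∩q : r ⊆ p ∩ q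
  r⊆p∩q i∈r = x∈p∩q⁺ (r⊆p i∈r , r⊆q i∈r)
... | no ∣p∩q∣≰∣r∣ = contradiction (trans (sym (p∩q≡ p ∣p∣ (p∩q⊆p p q)))
                                         (p∩q≡ q ∣q∣ (p∩q⊆q p q))) p≢q
  where
  p∩q≡ : ∀ s → ∣ s ∣ ≡ suc k → p ∩ q ⊆ s → p ∩ q ≡ s
  p∩q≡ s ∣s∣ p∩q⊆s = p⊆q∧∣q∣≤∣p∣⇒p≡q p∩q⊆s
    (subst (_≤ ∣ p ∩ q ∣) (sym (trans ∣s∣ (cong suc (sym ∣r∣)))) (ℕ.≰⇒> ∣p∩q∣≰∣r∣))

other-of-pair-unique : ∀ {A : Set} {y₁ y₂ a b b′ : A} →
  a ≡ y₁ ⊎ a ≡ y₂ → b ≡ y₁ ⊎ b ≡ y₂ → b′ ≡ y₁ ⊎ b′ ≡ y₂ → a ≢ b → a ≢ b′ → b ≡ b′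
other-of-pair-unique _          (inj₁ refl) (inj₁ refl) _   _    = refl
other-of-pair-unique _          (inj₂ refl) (inj₂ refl) _   _    = refl
other-of-pair-unique (inj₁ refl) (inj₁ refl) (inj₂ refl) a≢b _   = contradiction refl a≢b
other-of-pair-unique (inj₂ refl) (inj₂ refl) (inj₁ refl) a≢b _   = contradiction refl a≢b
other-of-pair-unique (inj₁ refl) (inj₂ refl) (inj₁ refl) _   a≢b′ = contradiction refl a≢b′
other-of-pair-unique (inj₂ refl) (inj₁ refl) (inj₂ refl) _   a≢b′ = contradiction refl a≢b′

allSubsets : (n : ℕ) → List (Subset n)
allSubsets zero    = [] ∷ []
allSubsets (suc n) = map (inside ∷_) (allSubsets n) ++ map (outside ∷_) (allSubsets n)

∈-allSubsets : (p : Subset n) → p ∈ allSubsets n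
∈-allSubsets []            = here refl
∈-allSubsets (inside ∷ p)  = ∈-++⁺ˡ (∈-map⁺ (inside ∷_) (∈-allSubsets p))
∈-allSubsets {suc n} (outside ∷ p) =
  ∈-++⁺ʳ (map (inside ∷_) (allSubsets n)) (∈-map⁺ (outside ∷_) (∈-allSubsets p))

facet-above : (X : SSet n) → p ∈ₛ X → ∃ λ f → IsFacetOf X f × p ⊆ f
facet-above X p∈X = go _ p∈X (⊃-wellFounded _)
  where
  go : ∀ p → p ∈ₛ X → Acc _⊃_ p → ∃ λ f → IsFacetOf X f × p ⊆ f
  go p p∈X (acc rec) with anySubset? (λ q → T? (X q) ×-dec (p ⊂? q))
  ... | yes (q , q∈X , p⊂q) =
    let f , f-facet , q⊆f = go q q∈X (rec p⊂q) in f , f-facet , ⊆-trans (proj₁ p⊂q) q⊆f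
  ... | no ∄q = p , (p∈X , λ q q∈X p⊆q →
                       sym (p⊆q∧p⊄q⇒p≡q p⊆q (λ p⊂q → ∄q (q , q∈X , p⊂q)))) , ⊆-refl

⁅_⁆ₛ : Subset n → SSet n
⁅ x ⁆ₛ y = isYes (y ≟ₛ x)

module _ {X : SSet n} {F : Subset n → ℤ} where

  module _ (ms : IsMorseStack X F) where

    flat-cover-unique : ∀ {x y y′} → FlatPair X F x y → FlatPair X F x y′ → y ≡ y′
    flat-cover-unique fp fp′ = proj₂ (proj₂ ms _ _ _ _ _ fp fp′ (inj₁ refl) (inj₁ refl))

    flat-facet-unique : ∀ {x x′ y} → FlatPair X F x y → FlatPair X F x′ y → x ≡ x′
    flat-facet-unique fp fp′ = proj₁ (proj₂ ms _ _ _ _ _ fp fp′ (inj₂ refl) (inj₂ refl))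

  module _ {l : ℤ} {A : SSet n} (min : IsMinimum X F l A) where

    minimum⊆ : ∀ {x} → x ∈ₛ A → x ∈ₛ X
    minimum⊆ x∈A = proj₁ (proj₁ (proj₁ min) _ x∈A)

    minimum-level : ∀ {x} → x ∈ₛ A → F x ≡ l
    minimum-level x∈A = ℤ.≤-antisym (proj₂ (proj₁ (proj₁ min) _ x∈A)) (proj₂ min _ x∈A)

    minimum-absorbs : ∀ {x y} → x ∈ₛ A → y ∈ₛ X → F y ≤ℤ F x → Comparable x y → y ∈ₛ A
    minimum-absorbs {x} {y} x∈A y∈X Fy≤Fx x~y = proj₂ (proj₂ (proj₁ min)) x y x∈A
      (y∈X , ℤ.≤-trans Fy≤Fx (proj₂ (proj₁ (proj₁ min) x x∈A))) x~y

  isolated⇒minimum : ∀ {x} → x ∈ₛ X →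
    (∀ {y} → Below X F (F x) y → Comparable x y → y ≡ x) → IsMinimum X F (F x) ⁅ x ⁆ₛ
  isolated⇒minimum {x} x∈X isolated = (below , connected , closed) , level
    where
    ∈⁅⁆ : ∀ {y} → y ∈ₛ ⁅ x ⁆ₛ → y ≡ x
    ∈⁅⁆ = toWitness
    ∈⁅⁆⁻ : ∀ {y} → y ≡ x → y ∈ₛ ⁅ x ⁆ₛ
    ∈⁅⁆⁻ = fromWitness
    below : ∀ y → y ∈ₛ ⁅ x ⁆ₛ → Below X F (F x) y
    below y y∈ with ∈⁅⁆ y∈
    ... | refl = x∈X , ℤ.≤-refl
    path : ∀ {y y′} → y ≡ x → y′ ≡ x → Star (PathStep ⁅ x ⁆ₛ) y y′
    path refl refl = ε
    connected : Connected ⁅ x ⁆ₛ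
    connected = (x , ∈⁅⁆⁻ refl) , λ y y′ y∈ y′∈ → path (∈⁅⁆ y∈) (∈⁅⁆ y′∈)
    closed : ∀ x′ y → x′ ∈ₛ ⁅ x ⁆ₛ → Below X F (F x) y → Comparable x′ y → y ∈ₛ ⁅ x ⁆ₛ
    closed x′ y x′∈ y-below x′~y with ∈⁅⁆ x′∈
    ... | refl = ∈⁅⁆⁻ (isolated y-below x′~y)
    level : ∀ y → y ∈ₛ ⁅ x ⁆ₛ → F x ≤ℤ F y
    level y y∈ with ∈⁅⁆ y∈
    ... | refl = ℤ.≤-refl

module ParentForest (R : Subset n → Set) (_⇝_ : Subset n → Subset n → Set)
  (h : Subset n → ℤ)
  (⇝-functional : ∀ {a b b′} → a ⇝ b → a ⇝ b′ → b ≡ b′)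
  (⇝-decreasing : ∀ {a b} → a ⇝ b → h b <ℤ h a) where

  record IsParentGraph (Y : Graph n) (vs : List (Subset n)) : Set where
    field
      vertex⇒root⊎listed : ∀ {x} → V Y x → R x ⊎ x ∈ vs
      listed⇒vertex      : ∀ {x} → x ∈ vs → V Y x
      listed⇒¬root       : ∀ {x} → x ∈ vs → ¬ R x
      root⇒vertex        : ∀ {x} → R x → V Y x
      edge⇒parent        : ∀ {a b} → E Y a b → (a ∈ vs × a ⇝ b) ⊎ (b ∈ vs × b ⇝ a)
      parent-edge         : ∀ {x} → x ∈ vs → ∃ λ u → x ⇝ u × E Y x u

  open IsParentGraph

  highest : ∀ a as → ∃ λ v → v ∈ a ∷ as × (∀ {y} → y ∈ a ∷ as → h y ≤ℤ h v)
  highest a as = argmax h a as , [ here , there ]′ (argmax-sel h a as) , maximal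
    where
    maximal : ∀ {y} → y ∈ a ∷ as → h y ≤ℤ h (argmax h a as)
    maximal (here refl) = f[⊥]≤f[argmax] {f = h} a as
    maximal (there y∈as) = lookup (f[xs]≤f[argmax] {f = h} a as) y∈as

  module _ {Y : Graph n} {vs : List (Subset n)} (pg : IsParentGraph Y vs)
           {v w : Subset n} (v∈vs : v ∈ vs) (v-highest : ∀ {y} → y ∈ vs → h y ≤ℤ h v)
           (v⇝w : v ⇝ w) where

    private
      no-child : ∀ {u} → u ∈ vs → ¬ u ⇝ v
      no-child u∈vs u⇝v = ℤ.<-irrefl refl (ℤ.<-≤-trans (⇝-decreasing u⇝v) (v-highest u∈vs))

    highest-free : E Y v w → FreePair Y v w
    highest-free vw = listed⇒vertex pg v∈vs , vw , λ u vu → only-parent (edge⇒parent pg vu)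
      where
      only-parent : ∀ {u} → (v ∈ vs × v ⇝ u) ⊎ (u ∈ vs × u ⇝ v) → u ≡ w
      only-parent (inj₁ (_ , v⇝u)) = ⇝-functional v⇝u v⇝w
      only-parent (inj₂ (u∈vs , u⇝v)) = contradiction u⇝v (no-child u∈vs)

    ≢v? : (x : Subset n) → Dec (x ≢ v)
    ≢v? x = ¬? (x ≟ₛ v)

    without-v : List (Subset n)
    without-v = filter ≢v? vs

    ∈without-v⁻ : ∀ {x} → x ∈ without-v → x ∈ vs × x ≢ v
    ∈without-v⁻ = ∈-filter⁻ ≢v? {xs = vs}

    shorter : length without-v < length vs
    shorter = filter-notAll ≢v? vs (Any.map (λ v≡x x≢v → x≢v (sym v≡x)) v∈vs)

    remove-highest : IsParentGraph (remove Y v w) without-v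
    remove-highest = record
      { vertex⇒root⊎listed = λ (x∈Y , x≢v) →
          [ inj₁ , (λ x∈vs → inj₂ (∈-filter⁺ ≢v? x∈vs x≢v)) ]′ (vertex⇒root⊎listed pg x∈Y)
      ; listed⇒vertex = λ x∈ → let x∈vs , x≢v = ∈without-v⁻ x∈ in listed⇒vertex pg x∈vs , x≢v
      ; listed⇒¬root = listed⇒¬root pg ∘ proj₁ ∘ ∈without-v⁻
      ; root⇒vertex = λ Rx → root⇒vertex pg Rx , λ x≡v → listed⇒¬root pg v∈vs (subst R x≡v Rx)
      ; edge⇒parent = λ (ab , ¬vw) → kept-parent ¬vw (edge⇒parent pg ab)
      ; parent-edge = kept-parent-edge ∘ ∈without-v⁻
      }
      where
      kept-parent-edge : ∀ {x} → x ∈ vs × x ≢ v → ∃ λ u → x ⇝ u × E (remove Y v w) x u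
      kept-parent-edge (x∈vs , x≢v) with parent-edge pg x∈vs
      ... | u , x⇝u , xu = u , x⇝u , xu , λ where
        (inj₁ (x≡v , _)) → x≢v x≡v
        (inj₂ (_ , refl)) → no-child x∈vs x⇝u
      kept-parent : ∀ {a b} → ¬ ((a ≡ v × b ≡ w) ⊎ (a ≡ w × b ≡ v)) →
        (a ∈ vs × a ⇝ b) ⊎ (b ∈ vs × b ⇝ a) →
        (a ∈ without-v × a ⇝ b) ⊎ (b ∈ without-v × b ⇝ a)
      kept-parent ¬vw (inj₁ (a∈vs , a⇝b)) = inj₁ (∈-filter⁺ ≢v? a∈vs (λ where
        refl → ¬vw (inj₁ (refl , ⇝-functional a⇝b v⇝w))) , a⇝b)
      kept-parent ¬vw (inj₂ (b∈vs , b⇝a)) = inj₂ (∈-filter⁺ ≢v? b∈vs (λ where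
        refl → ¬vw (inj₂ (⇝-functional b⇝a v⇝w , refl))) , b⇝a)

  parentGraph⇒forest : ∀ {Y vs} → IsParentGraph Y vs → Forest R Y
  parentGraph⇒forest {vs = vs} = go (suc (length vs)) ℕ.≤-refl
    where
    go : ∀ k {Y vs} → length vs < k → IsParentGraph Y vs → Forest R Y
    go (suc k) {vs = []} _ pg =
      base (λ _ x∈Y → [ id , (λ ()) ]′ (vertex⇒root⊎listed pg x∈Y)) (λ _ → root⇒vertex pg)
           (λ _ _ ab → [ (λ ()) ∘ proj₁ , (λ ()) ∘ proj₁ ]′ (edge⇒parent pg ab))
    go (suc k) {vs = a ∷ as} ∣vs∣<k pg =
      let v , v∈vs , v-highest = highest a as
          w , v⇝w , vw = parent-edge pg v∈vs
          pg′ = remove-highest pg v∈vs v-highest v⇝w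
      in step v w (highest-free pg v∈vs v-highest v⇝w vw) (λ _ → root⇒vertex pg′)
           (go k (ℕ.<-≤-trans (shorter pg v∈vs v-highest v⇝w) (ℕ.≤-pred ∣vs∣<k)) pg′)

module Watershed (d : ℕ) (M : SSet n) (F : Subset n → ℤ)
  (pm : IsNormalPseudomanifold d M) (ms : IsMorseStack M F) where

  face-nonempty : ∀ {x} → x ∈ₛ M → Nonempty x
  face-nonempty = proj₁ (proj₁ (proj₂ pm)) _

  face-closed : ∀ {x y} → x ∈ₛ M → y ⊆ x → Nonempty y → y ∈ₛ M
  face-closed = proj₂ (proj₁ (proj₂ pm)) _ _

  facet-dim : ∀ {x} → IsFacetOf M x → ∣ x ∣ ≡ suc d
  facet-dim = proj₁ (proj₂ (proj₂ (proj₂ pm))) _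

  ridge-cofaces : ∀ {x} → x ∈ₛ M → ∣ x ∣ ≡ d →
    Σ (Subset n) λ y₁ → Σ (Subset n) λ y₂ →
      y₁ ≢ y₂ × DFace d M y₁ × x ⊆ y₁ × DFace d M y₂ × x ⊆ y₂ ×
      (∀ y → DFace d M y → x ⊆ y → y ≡ y₁ ⊎ y ≡ y₂)
  ridge-cofaces = proj₁ (proj₂ (proj₂ (proj₂ (proj₂ pm)))) _

  stack : IsStack M F
  stack = proj₁ ms

  face-between : ∀ {x y z} → y ∈ₛ M → z ∈ₛ M → y ⊆ x → x ⊆ z → x ∈ₛ M
  face-between y∈M z∈M y⊆x x⊆z =
    let i , i∈y = face-nonempty y∈M in face-closed z∈M x⊆z (i , y⊆x i∈y)

  ∣face∣≤1+d : ∀ {x} → x ∈ₛ M → ∣ x ∣ ≤ suc d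
  ∣face∣≤1+d {x} x∈M =
    let _ , f-facet , x⊆f = facet-above M x∈M
    in subst (∣ x ∣ ≤_) (facet-dim f-facet) (p⊆q⇒∣p∣≤∣q∣ x⊆f)

  dFace-maximal : ∀ {x y} → DFace d M x → y ∈ₛ M → x ⊆ y → y ≡ x
  dFace-maximal {y = y} (_ , ∣x∣) y∈M x⊆y =
    sym (p⊆q∧∣q∣≤∣p∣⇒p≡q x⊆y (subst (∣ y ∣ ≤_) (sym ∣x∣) (∣face∣≤1+d y∈M)))

  ridge-above : ∀ {x} → x ∈ₛ M → ∣ x ∣ ≤ d → ∃ λ r → r ∈ₛ M × x ⊆ r × ∣ r ∣ ≡ d
  ridge-above x∈M ∣x∣≤d =
    let f , f-facet , x⊆f = facet-above M x∈M
        r , x⊆r , r⊆f , ∣r∣ = ∃-between _ f d x⊆f ∣x∣≤d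
                                (subst (d ≤_) (sym (facet-dim f-facet)) (ℕ.n≤1+n d))
    in r , face-between x∈M (proj₁ f-facet) x⊆r r⊆f , x⊆r , ∣r∣

  facetGraph-irreflexive : ∀ {a} → ¬ E (FacetGraph d M) a a
  facetGraph-irreflexive {a} ((_ , ∣a∣) , _ , _ , ∣a∩a∣) =
    ℕ.1+n≢n (trans (sym ∣a∣) (trans (cong ∣_∣ (sym (∩-idem a))) ∣a∩a∣))

  W : Graph n
  W = WatershedForest d M F

  -- The shared face t is kept abstract so that it can be transported along
  -- ∩-comm and ∩-distinct-covers.
  DrainsThrough : Subset n → Subset n → Subset n → Set
  DrainsThrough a b t = (DFace d M a × DFace d M b × t ∈ₛ M × ∣ t ∣ ≡ d) ×
                        DifferentialPair M F b t × FlatPair M F t a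

  infix 4 _⇝_
  _⇝_ : Subset n → Subset n → Set
  a ⇝ b = DrainsThrough a b (a ∩ b)

  ⇝⇒edge : ∀ {a b} → a ⇝ b → E W a b
  ⇝⇒edge (ab , diff , flat) = ab , inj₂ (diff , flat)

  ⇝⇒edge˘ : ∀ {a b} → a ⇝ b → E W b a
  ⇝⇒edge˘ {a} {b} a⇝b with subst (DrainsThrough a b) (∩-comm a b) a⇝b
  ... | (a∈ , b∈ , t∈ , ∣t∣) , diff , flat = (b∈ , a∈ , t∈ , ∣t∣) , inj₁ (diff , flat)

  edge⇒⇝ : ∀ {a b} → E W a b → a ⇝ b ⊎ b ⇝ a
  edge⇒⇝ (ab , inj₂ (diff , flat)) = inj₁ (ab , diff , flat)
  edge⇒⇝ {a} {b} ((a∈ , b∈ , t∈ , ∣t∣) , inj₁ (diff , flat)) =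
    inj₂ (subst (DrainsThrough b a) (∩-comm a b) ((b∈ , a∈ , t∈ , ∣t∣) , diff , flat))

  watershed-isGraph : IsGraph W
  watershed-isGraph =
    (λ _ _ ab → [ ⇝⇒edge˘ , ⇝⇒edge ]′ (edge⇒⇝ ab)) ,
    (λ _ (aa , _) → facetGraph-irreflexive aa) ,
    (λ _ _ ((a∈ , b∈ , _) , _) → a∈ , b∈)

  ⇝-decreasing : ∀ {a b} → a ⇝ b → F b <ℤ F a
  ⇝-decreasing {a} {b} (_ , (_ , Fb<Ft) , (_ , Ft≡Fa)) = subst (F b <ℤ_) Ft≡Fa Fb<Ft

  ⇝-irreflexive : ∀ {a b} → a ⇝ b → a ≢ b
  ⇝-irreflexive (ab , _) refl = facetGraph-irreflexive ab

  ⇝-functional : ∀ {a b b′} → a ⇝ b → a ⇝ b′ → b ≡ b′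
  ⇝-functional {a} {b} {b′} a⇝b@((a∈ , b∈ , t∈ , ∣t∣) , _ , flat) a⇝b′@((_ , b′∈ , _) , _ , flat′)
    with ridge-cofaces t∈ ∣t∣
  ... | _ , _ , _ , _ , _ , _ , _ , cofaces =
    other-of-pair-unique (cofaces a a∈ (p∩q⊆p a b)) (cofaces b b∈ (p∩q⊆q a b))
      (cofaces b′ b′∈ (subst (_⊆ b′) (sym (flat-facet-unique ms flat flat′)) (p∩q⊆q a b′)))
      (⇝-irreflexive a⇝b) (⇝-irreflexive a⇝b′)

  HasFlatFacet : Subset n → Set
  HasFlatFacet a = ∃ λ z → FlatPair M F z a

  hasFlatFacet? : ∀ a → Dec (HasFlatFacet a)
  hasFlatFacet? a = anySubset? λ z →
    (T? (M z) ×-dec T? (M a) ×-dec (z ⊆? a) ×-dec (∣ a ∣ ℕ.≟ suc ∣ z ∣)) ×-dec (F z ℤ.≟ F a)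

  DrainingFace : Subset n → Set
  DrainingFace x = DFace d M x × HasFlatFacet x

  drainingFace? : ∀ x → Dec (DrainingFace x)
  drainingFace? x = (T? (M x) ×-dec (∣ x ∣ ℕ.≟ suc d)) ×-dec hasFlatFacet? x

  ⇝-across : ∀ {a b z} → DFace d M a → FlatPair M F z a → DFace d M b → z ⊆ b → a ≢ b →
             a ⇝ b
  ⇝-across {a} {b} {z} a∈@(_ , ∣a∣) flat@((z∈M , _ , z⊆a , ∣a∣≡1+∣z∣) , _) b∈@(b∈M , ∣b∣)
           z⊆b a≢b =
    subst (DrainsThrough a b) (sym (∩-distinct-covers ∣a∣ ∣b∣ a≢b z⊆a z⊆b ∣z∣))
      ((a∈ , b∈ , z∈M , ∣z∣) , (zb , Fb<Fz) , flat)
    where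
    ∣z∣ : ∣ z ∣ ≡ d
    ∣z∣ = ℕ.suc-injective (trans (sym ∣a∣≡1+∣z∣) ∣a∣)
    zb : CoveringPair M z b
    zb = z∈M , b∈M , z⊆b , trans ∣b∣ (cong suc (sym ∣z∣))
    Fb<Fz : F b <ℤ F z
    Fb<Fz = ℤ.≤∧≢⇒< (stack z b z∈M b∈M z⊆b)
              λ Fb≡Fz → a≢b (flat-cover-unique ms flat (zb , sym Fb≡Fz))

  drainingFace⇒⇝ : ∀ {a} → DrainingFace a → ∃ (a ⇝_)
  drainingFace⇒⇝ {a} (a∈@(_ , ∣a∣) , z , flat@((z∈M , _ , z⊆a , ∣a∣≡1+∣z∣) , _))
    with ridge-cofaces z∈M (ℕ.suc-injective (trans (sym ∣a∣≡1+∣z∣) ∣a∣))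
  ... | y₁ , y₂ , y₁≢y₂ , y₁∈ , z⊆y₁ , y₂∈ , z⊆y₂ , cofaces with cofaces a a∈ z⊆a
  ...   | inj₁ refl = y₂ , ⇝-across a∈ flat y₂∈ z⊆y₂ y₁≢y₂
  ...   | inj₂ refl = y₁ , ⇝-across a∈ flat y₁∈ z⊆y₁ (y₁≢y₂ ∘ sym)

  ⇝⇒drainingFace : ∀ {a b} → a ⇝ b → DrainingFace a
  ⇝⇒drainingFace {a} {b} ((a∈ , _) , _ , flat) = a∈ , a ∩ b , flat

  lowerFace⇒flatFacet : ∀ {x y} → DFace d M x → y ∈ₛ M → y ⊆ x → y ≢ x → F y ≤ℤ F x →
                        HasFlatFacet x
  lowerFace⇒flatFacet {x} {y} (x∈M , ∣x∣) y∈M y⊆x y≢x Fy≤Fx =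
    let z , y⊆z , z⊆x , ∣z∣ = ∃-between y x d y⊆x ∣y∣≤d (subst (d ≤_) (sym ∣x∣) (ℕ.n≤1+n d))
        z∈M = face-between y∈M x∈M y⊆z z⊆x
    in z , (z∈M , x∈M , z⊆x , trans ∣x∣ (cong suc (sym ∣z∣))) ,
       ℤ.≤-antisym (ℤ.≤-trans (stack y z y∈M z∈M y⊆z) Fy≤Fx) (stack z x z∈M x∈M z⊆x)
    where
    ∣y∣≤d : ∣ y ∣ ≤ d
    ∣y∣≤d = ℕ.≤-pred (subst (suc ∣ y ∣ ≤_) ∣x∣ (ℕ.≰⇒> (y≢x ∘ p⊆q∧∣q∣≤∣p∣⇒p≡q y⊆x)))

  ¬flatFacet⇒InMin : ∀ {x} → DFace d M x → ¬ HasFlatFacet x → InMin M F x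
  ¬flatFacet⇒InMin {x} x∈ no-flat =
    F x , ⁅ x ⁆ₛ , isolated⇒minimum (proj₁ x∈) isolated , fromWitness refl
    where
    isolated : ∀ {y} → Below M F (F x) y → Comparable x y → y ≡ x
    isolated (y∈M , _) (inj₁ x⊆y) = dFace-maximal x∈ y∈M x⊆y
    isolated {y} (y∈M , Fy≤Fx) (inj₂ y⊆x) with y ≟ₛ x
    ... | yes y≡x = y≡x
    ... | no y≢x = contradiction (lowerFace⇒flatFacet x∈ y∈M y⊆x y≢x Fy≤Fx) no-flat

  ⇝⇒¬InMin : ∀ {x b} → x ⇝ b → ¬ InMin M F x
  ⇝⇒¬InMin {x} {b}
    ((_ , (b∈M , _) , t∈M , _) , ((_ , _ , t⊆b , _) , Fb<Ft) , ((_ , _ , t⊆x , _) , Ft≡Fx))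
    (_ , A , min , x∈A) =
    ℤ.<⇒≢ Fb<Ft (trans (minimum-level min b∈A) (sym (minimum-level min t∈A)))
    where
    t∈A : x ∩ b ∈ₛ A
    t∈A = minimum-absorbs min x∈A t∈M (ℤ.≤-reflexive Ft≡Fx) (inj₂ t⊆x)
    b∈A : b ∈ₛ A
    b∈A = minimum-absorbs min t∈A b∈M (ℤ.<⇒≤ Fb<Ft) (inj₁ t⊆b)

  minimum-upward : ∀ {l A x y} → IsMinimum M F l A → x ∈ₛ A → y ∈ₛ M → x ⊆ y → y ∈ₛ A
  minimum-upward min x∈A y∈M x⊆y =
    minimum-absorbs min x∈A y∈M (stack _ _ (minimum⊆ min x∈A) y∈M x⊆y) (inj₁ x⊆y)

  ridge∉minimum : ∀ {l A r} → IsMinimum M F l A → r ∈ₛ A → ∣ r ∣ ≢ d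
  ridge∉minimum {r = r} min r∈A ∣r∣ with ridge-cofaces (minimum⊆ min r∈A) ∣r∣
  ... | y₁ , y₂ , y₁≢y₂ , (y₁∈M , ∣y₁∣) , r⊆y₁ , (y₂∈M , ∣y₂∣) , r⊆y₂ , _ =
    y₁≢y₂ (flat-cover-unique ms (flat y₁∈M r⊆y₁ ∣y₁∣) (flat y₂∈M r⊆y₂ ∣y₂∣))
    where
    r∈M : r ∈ₛ M
    r∈M = minimum⊆ min r∈A
    flat : ∀ {y} → y ∈ₛ M → r ⊆ y → ∣ y ∣ ≡ suc d → FlatPair M F r y
    flat {y} y∈M r⊆y ∣y∣ =
      (r∈M , y∈M , r⊆y , trans ∣y∣ (cong suc (sym ∣r∣))) ,
      trans (minimum-level min r∈A) (sym (minimum-level min (minimum-upward min r∈A y∈M r⊆y)))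

  InMin⇒DFace : ∀ {x} → InMin M F x → DFace d M x
  InMin⇒DFace {x} (_ , _ , min , x∈A) with ∣ x ∣ ℕ.≟ suc d
  ... | yes ∣x∣ = minimum⊆ min x∈A , ∣x∣
  ... | no ∣x∣≢1+d =
    let x∈M = minimum⊆ min x∈A
        r , r∈M , x⊆r , ∣r∣ = ridge-above x∈M (ℕ.≤-pred (ℕ.≤∧≢⇒< (∣face∣≤1+d x∈M) ∣x∣≢1+d))
    in ⊥-elim (ridge∉minimum min (minimum-upward min x∈A r∈M x⊆r) ∣r∣)

  drainingFaces : List (Subset n)
  drainingFaces = filter drainingFace? (allSubsets n)

  open ParentForest (InMin M F) _⇝_ F ⇝-functional ⇝-decreasing

  watershed-parentGraph : IsParentGraph W drainingFaces
  watershed-parentGraph = record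
    { vertex⇒root⊎listed = λ {x} x∈ → root⊎listed x∈ (drainingFace? x)
    ; listed⇒vertex = proj₁ ∘ listed⇒draining
    ; listed⇒¬root = ⇝⇒¬InMin ∘ proj₂ ∘ drainingFace⇒⇝ ∘ listed⇒draining
    ; root⇒vertex = InMin⇒DFace
    ; edge⇒parent = Sum.map listed-parent listed-parent ∘ edge⇒⇝
    ; parent-edge = λ x∈ → let b , x⇝b = drainingFace⇒⇝ (listed⇒draining x∈)
                          in b , x⇝b , ⇝⇒edge x⇝b
    }
    where
    listed⇒draining : ∀ {x} → x ∈ drainingFaces → DrainingFace x
    listed⇒draining = proj₂ ∘ ∈-filter⁻ drainingFace? {xs = allSubsets n}
    draining⇒listed : ∀ {x} → DrainingFace x → x ∈ drainingFaces
    draining⇒listed {x} = ∈-filter⁺ drainingFace? (∈-allSubsets x)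
    root⊎listed : ∀ {x} → DFace d M x → Dec (DrainingFace x) → InMin M F x ⊎ x ∈ drainingFaces
    root⊎listed _  (yes x-draining) = inj₂ (draining⇒listed x-draining)
    root⊎listed x∈ (no ¬draining) = inj₁ (¬flatFacet⇒InMin x∈ (¬draining ∘ (x∈ ,_)))
    listed-parent : ∀ {a b} → a ⇝ b → a ∈ drainingFaces × a ⇝ b
    listed-parent a⇝b = draining⇒listed (⇝⇒drainingFace a⇝b) , a⇝b

proposition6 : (n d : ℕ) (M : SSet n) (F : Subset n → ℤ) →
    IsNormalPseudomanifold d M → IsMorseStack M F →
    IsSpanningForest d M F (WatershedForest d M F)
proposition6 n d M F pm ms =
  (watershed-isGraph , (λ _ x∈ → x∈) , (λ _ _ → proj₁)) ,
  parentGraph⇒forest watershed-parentGraph ,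
  (λ _ x∈ → x∈)
  where
  open Watershed d M F pm ms
  open ParentForest (InMin M F) _⇝_ F ⇝-functional ⇝-decreasing
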